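{- Let $G$ be a graph on $V$ and $G^*$ a graph on $V^*$, and suppose there is a non-empty $S\subseteq V$ such that $W^S_G$ has rank $\geq|V|-1$. Then $G$ is isomorphic to $G^*$ if and only if $(G,S)\sim(G^*,S^*)$ for some vertex set $S^*\subseteq V^*$. Furthermore, if $(G,S)\sim(G^*,S^*)$, then every bijection $\varphi:V\to V^*$ such that for all $v\in V$ the row of $W^{S^*}_{G^*}$ indexed by $\varphi(v)$ equals the row of $W^S_G$ indexed by $v$ is an isomorphism $G\to G^*$; there is exactly one such bijection if the rows of $W^S_G$ are pairwise distinct, and exactly two otherwise. (So the isomorphism is determined from the lex forms of $W^S_G$ and $W^{S^*}_{G^*}$, uniquely unless $W^S_G$ has a repeated row, in which case there are two.)
   Context: Graphs are finite, simple, undirected. For a graph $G$ on $V=\{v_1,\dots,v_n\}$ with adjacency matrix $A$ and $S\subseteq V$ with characteristic vector ${\rm e}\in\{0,1\}^n$, the walk matrix is $W^S_G=[{\rm e},A{\rm e},\dots,A^{n-1}{\rm e}]$, with rows indexed by the vertices. For graphs $G$ on $V$ and $G^*$ on $V^*$ and $S\subseteq V$, $S^*\subseteq V^*$, we write $(G,S)\sim(G^*,S^*)$ (walk equivalence) if $|V|=|V^*|$ and there is a bijection $\varphi:V\to V^*$ such that for every $v\in V$ the row of $W^{S^*}_{G^*}$ indexed by $\varphi(v)$ equals the row of $W^S_G$ indexed by $v$; equivalently $W^{S^*}_{G^*}=PW^S_G$ for a permutation matrix $P$, equivalently the two walk matrices have equal lexicographically row-sorted forms. -}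

module Defs where

open import Data.Nat using (ℕ; zero; suc; _+_; _*_; _∸_; _<_)
open import Data.Fin using (Fin; toℕ)
open import Data.Bool using (Bool; true; false; if_then_else_)
open import Data.Product using (Σ; ∃; ∃-syntax; _×_; _,_)
open import Data.Rational as ℚ using (ℚ)
open import Data.Integer using (+_)
open import Relation.Binary.PropositionalEquality using (_≡_; _≢_)
open import Relation.Nullary using (¬_)
open import Function.Definitions using (Bijective; Injective)

record Graph (n : ℕ) : Set where
  field
    adj    : Fin n → Fin n → Bool
    sym    : ∀ i j → adj i j ≡ adj j i
    irrefl : ∀ i → adj i i ≡ false
open Graph public

VSet : ℕ → Set
VSet n = Fin n → Bool

NonEmpty : ∀ {n} → VSet n → Set
NonEmpty S = ∃[ v ] S v ≡ true

b2n : Bool → ℕ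
b2n true  = 1
b2n false = 0

sumFin : ∀ {n} → (Fin n → ℕ) → ℕ
sumFin {zero}  f = 0
sumFin {suc n} f = f Data.Fin.zero + sumFin (λ i → f (Data.Fin.suc i))


sumFinℚ : ∀ {n} → (Fin n → ℚ) → ℚ
sumFinℚ {zero}  f = ℚ.0ℚ
sumFinℚ {suc n} f = f Data.Fin.zero ℚ.+ sumFinℚ (λ i → f (Data.Fin.suc i))

A : ∀ {n} → Graph n → Fin n → Fin n → ℕ
A G i j = b2n (adj G i j)

-- walk G S k v = (A^k e)_v, e the characteristic vector of S.
-- The walk matrix W^S_G has entry (v , k) = walk G S k v for k < n.
walk : ∀ {n} → Graph n → VSet n → ℕ → Fin n → ℕ
walk G S zero    v = b2n (S v)
walk G S (suc k) v = sumFin (λ j → A G v j * walk G S k j)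

column : ∀ {n} → Graph n → VSet n → Fin n → Fin n → ℚ
column G S k v = (+ walk G S (toℕ k) v) ℚ./ 1

-- rank over ℚ of W^S_G is ≥ r: there are r distinct columns which are
-- linearly independent over ℚ (rank = maximal number of linearly
-- independent columns).
RankAtLeast : ∀ {n} → Graph n → VSet n → ℕ → Set
RankAtLeast {n} G S r =
  Σ (Fin r → Fin n) λ f → Injective _≡_ _≡_ f ×
    (∀ (c : Fin r → ℚ) →
       (∀ v → sumFinℚ (λ j → c j ℚ.* column G S (f j) v) ≡ ℚ.0ℚ) →
       ∀ j → c j ≡ ℚ.0ℚ)

IsIso : ∀ {n m} → Graph n → Graph m → (Fin n → Fin m) → Set
IsIso G G* φ = Bijective _≡_ _≡_ φ × (∀ i j → adj G* (φ i) (φ j) ≡ adj G i j)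

Isomorphic : ∀ {n m} → Graph n → Graph m → Set
Isomorphic G G* = ∃[ φ ] IsIso G G* φ

RowMatch : ∀ {n m} → Graph n → VSet n → Graph m → VSet m → (Fin n → Fin m) → Set
RowMatch {n} G S G* S* φ = ∀ v k → k < n → walk G* S* k (φ v) ≡ walk G S k v

MatchingBij : ∀ {n m} → Graph n → VSet n → Graph m → VSet m → (Fin n → Fin m) → Set
MatchingBij G S G* S* φ = Bijective _≡_ _≡_ φ × RowMatch G S G* S* φ

WalkEquiv : ∀ {n m} → Graph n → VSet n → Graph m → VSet m → Set
WalkEquiv {n} {m} G S G* S* = n ≡ m × ∃[ φ ] MatchingBij G S G* S* φ

RowEq : ∀ {n} → Graph n → VSet n → Fin n → Fin n → Set
RowEq {n} G S u v = ∀ k → k < n → walk G S k u ≡ walk G S k v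

RowsDistinct : ∀ {n} → Graph n → VSet n → Set
RowsDistinct G S = ∀ u v → u ≢ v → ¬ RowEq G S u v

HasRepeatedRow : ∀ {n} → Graph n → VSet n → Set
HasRepeatedRow G S = ∃[ u ] ∃[ v ] (u ≢ v × RowEq G S u v)

_≗ᶠ_ : ∀ {n m} → (Fin n → Fin m) → (Fin n → Fin m) → Set
φ ≗ᶠ ψ = ∀ v → φ v ≡ ψ v

module Submission where

-- Let n = N + 1 and let X k = A^k e be the columns of the walk matrix W = W^S_G.  Because
-- X (k + 1) = A X k, a linear relation among X 0, …, X (N − 1) shifts to one among X 1, …, X N,
-- while the rank hypothesis makes the relations among X 0, …, X N at most one-dimensional;
-- together this forces X 0, …, X (N − 1) to be independent, so they span a hyperplane of ℚ^n,
-- and any two linear functionals vanishing on it are proportional.  If φ matches the rows of W with those of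
-- W* = W^{S*}_{G*}, then D v w = A v w − A* (φ v) (φ w) is symmetric with zero diagonal and kills
-- X 0, …, X (N − 1), as A X k = X (k + 1) and likewise for A*; proportionality of rows i and j of
-- D gives D i j ² = D i i · D j j = 0, so φ is an isomorphism.  Two pairs of equal rows of W give
-- functionals y ↦ y p − y p′ vanishing on the hyperplane, and their proportionality forces the
-- pairs to coincide; hence two row-matching bijections differ by the identity or by the
-- transposition of the unique repeated pair.  Conversely an isomorphism φ carries the walks of
-- (G, S) to those of (G*, φ S).

open import Defs hiding (sym)
open import Data.Nat as ℕ using (ℕ; zero; suc; _∸_)
import Data.Nat.Properties as ℕP
import Data.Nat.Coprimality as Coprimality
open import Data.Bool using (true; false)
import Data.Integer as ℤ
import Data.Integer.Properties as ℤP
open import Data.Rational as ℚ using (ℚ; 0ℚ; 1ℚ; _+_; _*_; -_; _-_; 1/_)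
import Data.Rational.Properties as ℚP
open import Data.Rational.Solver using (module +-*-Solver)
open import Data.Fin as F using (Fin; zero; suc; toℕ; punchIn)
import Data.Fin.Properties as FP
open import Data.Fin.Permutation as Perm using (Permutation; _⟨$⟩ʳ_; _⟨$⟩ˡ_)
open import Data.Fin.Permutation.Components using (transpose)
open import Data.Vec.Functional using (Vector; _∷_; insertAt)
import Data.Vec.Functional.Properties as VecP
open import Data.Product using (∃-syntax; _×_; _,_; proj₁; proj₂)
open import Data.Sum using (_⊎_; inj₁; inj₂; [_,_]′)
open import Data.Empty using (⊥-elim)
open import Algebra.Bundles using (CommutativeRing)
import Algebra.Properties.Semiring.Sum as SemiringSum
import Algebra.Properties.CommutativeMonoid.Sum as MonoidSum
open import Relation.Nullary using (¬_; ¬?; yes; no; contradiction)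
open import Relation.Nullary.Decidable using (decidable-stable)
open import Relation.Binary.PropositionalEquality
  using (_≡_; _≢_; refl; sym; trans; cong; cong₂; subst; ≢-sym; module ≡-Reasoning)
open import Function using (_∘_)
open import Function.Definitions using (Injective; Bijective)
open import Function.Bundles using (Bijection; mk⤖; _⇔_; mk⇔)
open import Function.Properties.Bijection using (⤖⇒↔)
open import Function.Properties.Inverse using (↔⇒⤖)
open import Function.Consequences.Propositional using (strictlySurjective⇒surjective)
import Function.Construct.Composition as Compose

open +-*-Solver

module ℚΣ = SemiringSum (CommutativeRing.semiring ℚP.+-*-commutativeRing)
open ℚΣ using (sum; sum-syntax)
module ℕΣ = MonoidSum ℕP.+-0-commutativeMonoid

p≢0∧p*q≡0⇒q≡0 : ∀ {p q : ℚ} → p ≢ 0ℚ → p * q ≡ 0ℚ → q ≡ 0ℚ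
p≢0∧p*q≡0⇒q≡0 {p} {q} p≢0 pq≡0 = begin
  q                ≡⟨ ℚP.*-identityˡ q ⟨
  1ℚ * q           ≡⟨ cong (_* q) (ℚP.*-inverseˡ p) ⟨
  (1/ p * p) * q   ≡⟨ ℚP.*-assoc (1/ p) p q ⟩
  1/ p * (p * q)   ≡⟨ cong (1/ p *_) pq≡0 ⟩
  1/ p * 0ℚ        ≡⟨ ℚP.*-zeroʳ (1/ p) ⟩
  0ℚ               ∎
  where
  open ≡-Reasoning
  instance _ = ℚ.≢-nonZero p≢0

x-y≡0⇒x≡y : ∀ {x y : ℚ} → x - y ≡ 0ℚ → x ≡ y
x-y≡0⇒x≡y {x} {y} x-y≡0 = begin
  x             ≡⟨ solve 2 (λ x y → x := (x :- y) :+ y) refl x y ⟩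
  (x - y) + y   ≡⟨ cong (_+ y) x-y≡0 ⟩
  0ℚ + y        ≡⟨ ℚP.+-identityˡ y ⟩
  y             ∎
  where open ≡-Reasoning

singular-2×2 : ∀ {a b c d g h : ℚ} → g ≢ 0ℚ ⊎ h ≢ 0ℚ →
               g * a + h * b ≡ 0ℚ → g * c + h * d ≡ 0ℚ → a * d ≡ b * c
singular-2×2 {a} {b} {c} {d} {g} {h} nontrivial row₁ row₂ = x-y≡0⇒x≡y det≡0
  where
  open ≡-Reasoning
  det = a * d - b * c
  vanish : ∀ p q → p * 0ℚ - q * 0ℚ ≡ 0ℚ
  vanish = solve 2 (λ p q → p :* con 0ℚ :- q :* con 0ℚ := con 0ℚ) refl
  g·det≡0 : g * det ≡ 0ℚ
  g·det≡0 = begin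
    g * det                                     ≡⟨ expand a b c d g h ⟩
    d * (g * a + h * b) - b * (g * c + h * d)   ≡⟨ cong₂ (λ p q → d * p - b * q) row₁ row₂ ⟩
    d * 0ℚ - b * 0ℚ                             ≡⟨ vanish d b ⟩
    0ℚ                                          ∎
    where
    expand = solve 6 (λ a b c d g h → g :* (a :* d :- b :* c)
                                      := d :* (g :* a :+ h :* b) :- b :* (g :* c :+ h :* d)) refl
  h·det≡0 : h * det ≡ 0ℚ
  h·det≡0 = begin
    h * det                                     ≡⟨ expand a b c d g h ⟩
    a * (g * c + h * d) - c * (g * a + h * b)   ≡⟨ cong₂ (λ p q → a * p - c * q) row₂ row₁ ⟩
    a * 0ℚ - c * 0ℚ                             ≡⟨ vanish a c ⟩
    0ℚ                                          ∎
    where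
    expand = solve 6 (λ a b c d g h → h :* (a :* d :- b :* c)
                                      := a :* (g :* c :+ h :* d) :- c :* (g :* a :+ h :* b)) refl
  det≡0 : det ≡ 0ℚ
  det≡0 = [ (λ g≢0 → p≢0∧p*q≡0⇒q≡0 g≢0 g·det≡0) , (λ h≢0 → p≢0∧p*q≡0⇒q≡0 h≢0 h·det≡0) ]′
            nontrivial

sum-zero : ∀ {n} → sum {n} (λ _ → 0ℚ) ≡ 0ℚ
sum-zero {n} = ℚΣ.sum-replicate-zero n

infix 7 _·_
_·_ : ∀ {n} → Vector ℚ n → Vector ℚ n → ℚ
_·_ {n} u y = ∑[ w < n ] (u w * y w)

·-zeroʳ : ∀ {n} (u : Vector ℚ n) → u · (λ _ → 0ℚ) ≡ 0ℚ
·-zeroʳ {n} u = trans (ℚΣ.sum-cong-≗ (λ w → ℚP.*-zeroʳ (u w))) (sum-zero {n})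

·-comm : ∀ {n} (u y : Vector ℚ n) → u · y ≡ y · u
·-comm u y = ℚΣ.sum-cong-≗ (λ w → ℚP.*-comm (u w) (y w))

linearCombination : ∀ {r n} → Vector ℚ r → (Fin r → Vector ℚ n) → Vector ℚ n
linearCombination {r} c x w = ∑[ j < r ] (c j * x j w)

·-linearCombination : ∀ {r n} (u : Vector ℚ n) (c : Vector ℚ r) (x : Fin r → Vector ℚ n) →
                      u · linearCombination c x ≡ ∑[ j < r ] (c j * (u · x j))
·-linearCombination {r} {n} u c x = begin
  ∑[ w < n ] (u w * (∑[ j < r ] (c j * x j w)))
    ≡⟨ ℚΣ.sum-cong-≗ (λ w → ℚΣ.*-distribˡ-sum {r} (u w) _) ⟩
  ∑[ w < n ] (∑[ j < r ] (u w * (c j * x j w)))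
    ≡⟨ ℚΣ.∑-comm (λ w j → u w * (c j * x j w)) ⟩
  ∑[ j < r ] (∑[ w < n ] (u w * (c j * x j w)))
    ≡⟨ ℚΣ.sum-cong-≗ (λ j → ℚΣ.sum-cong-≗ (λ w → swap (u w) (c j) (x j w))) ⟩
  ∑[ j < r ] (∑[ w < n ] (c j * (u w * x j w)))
    ≡⟨ ℚΣ.sum-cong-≗ (λ j → ℚΣ.*-distribˡ-sum {n} (c j) _) ⟨
  ∑[ j < r ] (c j * (u · x j))
    ∎
  where
  open ≡-Reasoning
  swap : ∀ a b z → a * (b * z) ≡ b * (a * z)
  swap = solve 3 (λ a b z → a :* (b :* z) := b :* (a :* z)) refl

·-distribʳ-− : ∀ {n} (a b y : Vector ℚ n) → (λ w → a w - b w) · y ≡ a · y - b · y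
·-distribʳ-− {n} a b y = begin
  ∑[ w < n ] ((a w - b w) * y w)                ≡⟨ ℚΣ.sum-cong-≗ (λ w → expand (a w) (b w) (y w)) ⟩
  ∑[ w < n ] (a w * y w + - 1ℚ * (b w * y w))   ≡⟨ ℚΣ.∑-distrib-+ (λ w → a w * y w) _ ⟩
  a · y + ∑[ w < n ] (- 1ℚ * (b w * y w))       ≡⟨ cong (a · y +_) (ℚΣ.*-distribˡ-sum {n} (- 1ℚ) _) ⟨
  a · y + - 1ℚ * (b · y)                        ≡⟨ collapse (a · y) (b · y) ⟩
  a · y - b · y                                 ∎
  where
  open ≡-Reasoning
  expand : ∀ p q z → (p - q) * z ≡ p * z + - 1ℚ * (q * z)
  expand = solve 3 (λ p q z → (p :- q) :* z := p :* z :+ (:- con 1ℚ) :* (q :* z)) refl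
  collapse : ∀ p q → p + - 1ℚ * q ≡ p - q
  collapse = solve 2 (λ p q → p :+ (:- con 1ℚ) :* q := p :- q) refl

δ : ∀ {n} → Fin n → Vector ℚ n
δ i w with i F.≟ w
... | yes _ = 1ℚ
... | no _  = 0ℚ

δ-diag : ∀ {n} (i : Fin n) → δ i i ≡ 1ℚ
δ-diag i with i F.≟ i
... | yes _   = refl
... | no i≢i  = contradiction refl i≢i

δ-off : ∀ {n} {i w : Fin n} → i ≢ w → δ i w ≡ 0ℚ
δ-off {i = i} {w} i≢w with i F.≟ w
... | yes i≡w = contradiction i≡w i≢w
... | no _    = refl

·-δ : ∀ {n} (u : Vector ℚ n) (i : Fin n) → u · δ i ≡ u i
·-δ {suc n} u i = begin
  u · δ i                                          ≡⟨ ℚΣ.sum-remove {i = i} (λ w → u w * δ i w) ⟩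
  u i * δ i i + ∑[ l < n ] (u (i′ l) * δ i (i′ l)) ≡⟨ cong₂ _+_ (cong (u i *_) (δ-diag i)) off-diagonal ⟩
  u i * 1ℚ + 0ℚ                                    ≡⟨ ℚP.+-identityʳ (u i * 1ℚ) ⟩
  u i * 1ℚ                                         ≡⟨ ℚP.*-identityʳ (u i) ⟩
  u i                                              ∎
  where
  open ≡-Reasoning
  i′ = punchIn i
  off-diagonal : ∑[ l < n ] (u (i′ l) * δ i (i′ l)) ≡ 0ℚ
  off-diagonal = trans (ℚΣ.sum-cong-≗ (λ l → trans (cong (u (i′ l) *_) (δ-off (≢-sym (FP.punchInᵢ≢i i l))))
                                                   (ℚP.*-zeroʳ (u (i′ l)))))
                       (sum-zero {n})

-- Linear dependence

Independent : ∀ {r n} → (Fin r → Vector ℚ n) → Set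
Independent x = ∀ c → (∀ w → linearCombination c x w ≡ 0ℚ) → ∀ j → c j ≡ 0ℚ

Dependent : ∀ {r n} → (Fin r → Vector ℚ n) → Set
Dependent x = ∃[ c ] (∃[ j ] c j ≢ 0ℚ) × (∀ w → linearCombination c x w ≡ 0ℚ)

nonzero-or-all-zero : ∀ {n} (a : Vector ℚ n) → (∃[ k ] a k ≢ 0ℚ) ⊎ (∀ k → a k ≡ 0ℚ)
nonzero-or-all-zero a with FP.any? (λ k → ¬? (a k ℚP.≟ 0ℚ))
... | yes found = inj₁ found
... | no  none  = inj₂ (λ k → decidable-stable (a k ℚP.≟ 0ℚ) (λ ak≢0 → none (k , ak≢0)))

dependent-if-zero-column : ∀ {N} (v : Fin (suc (suc N)) → Vector ℚ (suc N)) →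
                           (∀ k → v k zero ≡ 0ℚ) → Dependent (λ l w → v (suc l) (suc w)) → Dependent v
dependent-if-zero-column {N} v column≡0 (γ , (l , γl≢0) , rel) = (0ℚ ∷ γ) , (suc l , γl≢0) , rel′
  where
  rel′ : ∀ w → linearCombination (0ℚ ∷ γ) v w ≡ 0ℚ
  rel′ zero    = cong₂ _+_ (ℚP.*-zeroˡ (v zero zero))
                   (trans (ℚΣ.sum-cong-≗ (λ k → trans (cong (γ k *_) (column≡0 (suc k))) (ℚP.*-zeroʳ (γ k))))
                          (sum-zero {suc N}))
  rel′ (suc w) = trans (cong (_+ rest) (ℚP.*-zeroˡ (v zero (suc w)))) (trans (ℚP.+-identityˡ rest) (rel w))
    where rest = linearCombination γ (λ l w′ → v (suc l) (suc w′)) w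

∑-eliminated : ∀ {M} (γ y b : Vector ℚ M) (a V : ℚ) →
               ∑[ k < M ] (γ k * (a * y k - b k * V)) ≡
               - ∑[ k < M ] (γ k * b k) * V + ∑[ k < M ] (a * γ k * y k)
∑-eliminated {M} γ y b a V = begin
  ∑[ k < M ] (γ k * (a * y k - b k * V))
    ≡⟨ ℚΣ.sum-cong-≗ (λ k → distribute (γ k) (y k) (b k)) ⟩
  ∑[ k < M ] (a * γ k * y k + - V * (γ k * b k))
    ≡⟨ ℚΣ.∑-distrib-+ (λ k → a * γ k * y k) (λ k → - V * (γ k * b k)) ⟩
  ∑[ k < M ] (a * γ k * y k) + ∑[ k < M ] (- V * (γ k * b k))
    ≡⟨ cong (∑[ k < M ] (a * γ k * y k) +_) (ℚΣ.*-distribˡ-sum (- V) (λ k → γ k * b k)) ⟨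
  ∑[ k < M ] (a * γ k * y k) + - V * ∑[ k < M ] (γ k * b k)
    ≡⟨ rearrange (∑[ k < M ] (a * γ k * y k)) (∑[ k < M ] (γ k * b k)) ⟩
  - ∑[ k < M ] (γ k * b k) * V + ∑[ k < M ] (a * γ k * y k)
    ∎
  where
  open ≡-Reasoning
  distribute : ∀ g z t → g * (a * z - t * V) ≡ a * g * z + - V * (g * t)
  distribute g z t = solve 5 (λ g z t a V → g :* (a :* z :- t :* V) := a :* g :* z :+ (:- V) :* (g :* t))
                             refl g z t a V
  rearrange : ∀ t s → t + - V * s ≡ - s * V + t
  rearrange t s = solve 3 (λ t s V → t :+ (:- V) :* s := (:- s) :* V :+ t) refl t s V

eliminate : ∀ {N} → (Fin (suc (suc N)) → Vector ℚ (suc N)) → Fin (suc (suc N)) →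
            Fin (suc N) → Vector ℚ N
eliminate v p l w = v p zero * v (punchIn p l) (suc w) - v (punchIn p l) zero * v p (suc w)

dependent-by-elimination : ∀ {N} (v : Fin (suc (suc N)) → Vector ℚ (suc N)) (p : Fin (suc (suc N))) →
                           v p zero ≢ 0ℚ → Dependent (eliminate v p) → Dependent v
dependent-by-elimination {N} v p a≢0 (γ , (l , γl≢0) , rel) = c , (punchIn p l , c[pl]≢0) , rel′
  where
  open ≡-Reasoning
  a = v p zero
  p′ = punchIn p
  S = ∑[ k < suc N ] (γ k * v (p′ k) zero)
  c = insertAt (λ k → a * γ k) p (- S)
  c[pl]≢0 : c (p′ l) ≢ 0ℚ
  c[pl]≢0 rewrite VecP.insertAt-punchIn (λ k → a * γ k) p (- S) l = γl≢0 ∘ p≢0∧p*q≡0⇒q≡0 a≢0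
  split : ∀ w → linearCombination c v w ≡ - S * v p w + ∑[ k < suc N ] (a * γ k * v (p′ k) w)
  split w = trans (ℚΣ.sum-remove {i = p} (λ k → c k * v k w))
    (cong₂ _+_ (cong (_* v p w) (VecP.insertAt-lookup (λ k → a * γ k) p (- S)))
               (ℚΣ.sum-cong-≗ (λ k → cong (_* v (p′ k) w) (VecP.insertAt-punchIn (λ k → a * γ k) p (- S) k))))
  first-row : - S * a + ∑[ k < suc N ] (a * γ k * v (p′ k) zero) ≡ 0ℚ
  first-row = begin
    - S * a + ∑[ k < suc N ] (a * γ k * v (p′ k) zero)
      ≡⟨ cong (- S * a +_) (ℚΣ.sum-cong-≗ (λ k → ℚP.*-assoc a (γ k) (v (p′ k) zero))) ⟩
    - S * a + ∑[ k < suc N ] (a * (γ k * v (p′ k) zero))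
      ≡⟨ cong (- S * a +_) (ℚΣ.*-distribˡ-sum a (λ k → γ k * v (p′ k) zero)) ⟨
    - S * a + a * S
      ≡⟨ solve 2 (λ s x → (:- s) :* x :+ x :* s := con 0ℚ) refl S a ⟩
    0ℚ ∎
  rel′ : ∀ w → linearCombination c v w ≡ 0ℚ
  rel′ zero    = trans (split zero) first-row
  rel′ (suc w) = trans (split (suc w))
    (trans (sym (∑-eliminated γ (λ k → v (p′ k) (suc w)) (λ k → v (p′ k) zero) a (v p (suc w)))) (rel w))

excess-vectors-dependent : ∀ N (v : Fin (suc N) → Vector ℚ N) → Dependent v
excess-vectors-dependent zero    v = (λ _ → 1ℚ) , (zero , ℚP.1≢0) , λ ()
excess-vectors-dependent (suc N) v with nonzero-or-all-zero (λ k → v k zero)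
... | inj₁ (p , a≢0) = dependent-by-elimination v p a≢0 (excess-vectors-dependent N (eliminate v p))
... | inj₂ column≡0  =
  dependent-if-zero-column v column≡0 (excess-vectors-dependent N (λ l w → v (suc l) (suc w)))

relation-head≢0 : ∀ {N n} {a b : Vector ℚ n} (x : Fin N → Vector ℚ n) → Independent x →
                  ∀ γ → (∃[ l ] γ l ≢ 0ℚ) → (∀ w → linearCombination γ (a ∷ b ∷ x) w ≡ 0ℚ) →
                  γ zero ≢ 0ℚ ⊎ γ (suc zero) ≢ 0ℚ
relation-head≢0 {a = a} {b} x x-indep γ (l , γl≢0) rel with γ zero ℚP.≟ 0ℚ | γ (suc zero) ℚP.≟ 0ℚ
... | no γ₀≢0  | _        = inj₁ γ₀≢0
... | yes _    | no γ₁≢0  = inj₂ γ₁≢0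
... | yes γ₀≡0 | yes γ₁≡0 = contradiction (γ≡0 l) γl≢0
  where
  tail-rel : ∀ w → linearCombination (λ k → γ (suc (suc k))) x w ≡ 0ℚ
  tail-rel w = trans (sym (head-vanishes (a w) (b w) _)) (rel w)
    where
    head-vanishes : ∀ p q t → γ zero * p + (γ (suc zero) * q + t) ≡ t
    head-vanishes p q t rewrite γ₀≡0 | γ₁≡0 =
      solve 3 (λ p q t → con 0ℚ :* p :+ (con 0ℚ :* q :+ t) := t) refl p q t
  γ≡0 : ∀ l → γ l ≡ 0ℚ
  γ≡0 zero          = γ₀≡0
  γ≡0 (suc zero)    = γ₁≡0
  γ≡0 (suc (suc k)) = x-indep (λ k → γ (suc (suc k))) tail-rel k

annihilator-on-relation : ∀ {N n} {a b : Vector ℚ n} (u : Vector ℚ n) (x : Fin N → Vector ℚ n) →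
                          (∀ k → u · x k ≡ 0ℚ) → ∀ γ → (∀ w → linearCombination γ (a ∷ b ∷ x) w ≡ 0ℚ) →
                          γ zero * (u · a) + γ (suc zero) * (u · b) ≡ 0ℚ
annihilator-on-relation {N} {a = a} {b} u x u⊥x γ rel = begin
  γ₀ * (u · a) + γ₁ * (u · b)                        ≡⟨ cong (γ₀ * (u · a) +_) (ℚP.+-identityʳ _) ⟨
  γ₀ * (u · a) + (γ₁ * (u · b) + 0ℚ)                 ≡⟨ cong (λ t → γ₀ * (u · a) + (γ₁ * (u · b) + t)) tail≡0 ⟨
  ∑[ l < suc (suc N) ] (γ l * (u · (a ∷ b ∷ x) l))   ≡⟨ ·-linearCombination u γ (a ∷ b ∷ x) ⟨
  u · linearCombination γ (a ∷ b ∷ x)                ≡⟨ ℚΣ.sum-cong-≗ (λ w → cong (u w *_) (rel w)) ⟩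
  u · (λ _ → 0ℚ)                                     ≡⟨ ·-zeroʳ u ⟩
  0ℚ                                                 ∎
  where
  open ≡-Reasoning
  γ₀ = γ zero
  γ₁ = γ (suc zero)
  tail≡0 : ∑[ k < N ] (γ (suc (suc k)) * (u · x k)) ≡ 0ℚ
  tail≡0 = trans (ℚΣ.sum-cong-≗ (λ k → trans (cong (γ (suc (suc k)) *_) (u⊥x k)) (ℚP.*-zeroʳ (γ (suc (suc k))))))
                 (sum-zero {N})

-- The N + 2 vectors δ i, δ j, x 0, …, x (N − 1) of ℚ^(N+1) are dependent, and the dependency
-- involves δ i or δ j; applying r and s to it gives a singular 2×2 system.
annihilators-proportional : ∀ {N} (x : Fin N → Vector ℚ (suc N)) → Independent x →
                            ∀ r s → (∀ k → r · x k ≡ 0ℚ) → (∀ k → s · x k ≡ 0ℚ) →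
                            ∀ i j → r i * s j ≡ r j * s i
annihilators-proportional {N} x x-indep r s r⊥x s⊥x i j
  with excess-vectors-dependent (suc N) (δ i ∷ δ j ∷ x)
... | γ , γ≢0 , rel = singular-2×2 (relation-head≢0 x x-indep γ γ≢0 rel) (on r r⊥x) (on s s⊥x)
  where
  on : ∀ u → (∀ k → u · x k ≡ 0ℚ) → γ zero * u i + γ (suc zero) * u j ≡ 0ℚ
  on u u⊥x = trans (cong₂ (λ p q → γ zero * p + γ (suc zero) * q) (sym (·-δ u i)) (sym (·-δ u j)))
                   (annihilator-on-relation u x u⊥x γ rel)

symmetric-hollow-annihilator≡0 : ∀ {N} (x : Fin N → Vector ℚ (suc N)) → Independent x →
                                 ∀ (D : Fin (suc N) → Vector ℚ (suc N)) →
                                 (∀ i j → D i j ≡ D j i) → (∀ i → D i i ≡ 0ℚ) → (∀ i k → D i · x k ≡ 0ℚ) →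
                                 ∀ i j → D i j ≡ 0ℚ
symmetric-hollow-annihilator≡0 x x-indep D D-sym D-hollow D⊥x i j =
  decidable-stable (D i j ℚP.≟ 0ℚ) (λ Dij≢0 → Dij≢0 (p≢0∧p*q≡0⇒q≡0 Dij≢0 Dij²≡0))
  where
  open ≡-Reasoning
  Dij²≡0 : D i j * D i j ≡ 0ℚ
  Dij²≡0 = begin
    D i j * D i j   ≡⟨ cong (D i j *_) (D-sym i j) ⟩
    D i j * D j i   ≡⟨ annihilators-proportional x x-indep (D i) (D j) (D⊥x i) (D⊥x j) i j ⟨
    D i i * D j j   ≡⟨ cong (_* D j j) (D-hollow i) ⟩
    0ℚ * D j j      ≡⟨ ℚP.*-zeroˡ (D j j) ⟩
    0ℚ              ∎

separator : ∀ {n} → Fin n → Fin n → Vector ℚ n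
separator p p′ w = δ p w - δ p′ w

separator-· : ∀ {n} (p p′ : Fin n) (y : Vector ℚ n) → separator p p′ · y ≡ y p - y p′
separator-· p p′ y = begin
  separator p p′ · y   ≡⟨ ·-distribʳ-− (δ p) (δ p′) y ⟩
  δ p · y - δ p′ · y   ≡⟨ cong₂ _-_ (trans (·-comm (δ p) y) (·-δ y p)) (trans (·-comm (δ p′) y) (·-δ y p′)) ⟩
  y p - y p′           ∎
  where open ≡-Reasoning

separator-at : ∀ {n} {p p′ w : Fin n} → p ≢ w → p′ ≢ w → separator p p′ w ≡ 0ℚ
separator-at p≢w p′≢w = cong₂ _-_ (δ-off p≢w) (δ-off p′≢w)

separator-self : ∀ {n} {p p′ : Fin n} → p′ ≢ p → separator p p′ p ≡ 1ℚ
separator-self {p = p} p′≢p = cong₂ _-_ (δ-diag p) (δ-off p′≢p)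

identified-pairs-coincide : ∀ {N} (x : Fin N → Vector ℚ (suc N)) → Independent x →
                            ∀ {p p′ q q′} → p ≢ p′ → q ≢ q′ →
                            (∀ k → x k p ≡ x k p′) → (∀ k → x k q ≡ x k q′) → q ≡ p ⊎ q ≡ p′
identified-pairs-coincide x x-indep {p} {p′} {q} {q′} p≢p′ q≢q′ x[p]≡x[p′] x[q]≡x[q′]
  with q F.≟ p | q F.≟ p′
... | yes q≡p | _        = inj₁ q≡p
... | no _    | yes q≡p′ = inj₂ q≡p′
... | no q≢p  | no q≢p′  = contradiction 1≡0 ℚP.1≢0
  where
  open ≡-Reasoning
  annihilates : ∀ {a a′} → (∀ k → x k a ≡ x k a′) → ∀ k → separator a a′ · x k ≡ 0ℚ
  annihilates {a} {a′} x[a]≡x[a′] k =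
    trans (separator-· a a′ (x k)) (trans (cong (_- x k a′) (x[a]≡x[a′] k)) (ℚP.+-inverseʳ (x k a′)))
  1≡0 : 1ℚ ≡ 0ℚ
  1≡0 = begin
    1ℚ
      ≡⟨ cong₂ _*_ (separator-self (≢-sym p≢p′)) (separator-self (≢-sym q≢q′)) ⟨
    separator p p′ p * separator q q′ q
      ≡⟨ annihilators-proportional x x-indep (separator p p′) (separator q q′)
                                   (annihilates x[p]≡x[p′]) (annihilates x[q]≡x[q′]) p q ⟩
    separator p p′ q * separator q q′ p
      ≡⟨ cong (_* separator q q′ p) (separator-at (≢-sym q≢p) (≢-sym q≢p′)) ⟩
    0ℚ * separator q q′ p
      ≡⟨ ℚP.*-zeroˡ (separator q q′ p) ⟩
    0ℚ ∎

-- Maps between finite sets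

injective⇒strictlySurjective : ∀ {n} {f : Fin n → Fin n} → Injective _≡_ _≡_ f → ∀ y → ∃[ x ] f x ≡ y
injective⇒strictlySurjective {suc n} {f} f-inj y with FP.any? (λ x → f x F.≟ y)
... | yes hit  = hit
... | no  miss = contradiction (FP.injective⇒≤ punched-inj) ℕP.1+n≰n
  where
  punched : Fin (suc n) → Fin n
  punched x = F.punchOut {i = y} {j = f x} (λ y≡fx → miss (x , sym y≡fx))
  punched-inj : Injective _≡_ _≡_ punched
  punched-inj {x} {x′} eq =
    f-inj (FP.punchOut-injective (λ e → miss (x , sym e)) (λ e → miss (x′ , sym e)) eq)

injective⇒bijective : ∀ {n} {f : Fin n → Fin n} → Injective _≡_ _≡_ f → Bijective _≡_ _≡_ f
injective⇒bijective f-inj = f-inj , strictlySurjective⇒surjective (injective⇒strictlySurjective f-inj)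

injective⇒missing : ∀ {n} {f : Fin n → Fin (suc n)} → Injective _≡_ _≡_ f → ∃[ m ] (∀ j → f j ≢ m)
injective⇒missing {n} {f} f-inj with FP.any? (λ m → FP.all? (λ j → ¬? (f j F.≟ m)))
... | yes found = found
... | no  none  = contradiction (FP.injective⇒≤ preimage-inj) ℕP.1+n≰n
  where
  preimage : ∀ m → ∃[ j ] f j ≡ m
  preimage m with FP.any? (λ j → f j F.≟ m)
  ... | yes hit  = hit
  ... | no  miss = ⊥-elim (none (m , λ j fj≡m → miss (j , fj≡m)))
  preimage-inj : Injective _≡_ _≡_ (proj₁ ∘ preimage)
  preimage-inj {m} {m′} eq = trans (sym (proj₂ (preimage m))) (trans (cong f eq) (proj₂ (preimage m′)))

bijective⇒permutation : ∀ {n m} {φ : Fin n → Fin m} → Bijective _≡_ _≡_ φ → Permutation n m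
bijective⇒permutation φ-bij = ⤖⇒↔ (mk⤖ φ-bij)

inverse : ∀ {n m} {φ : Fin n → Fin m} → Bijective _≡_ _≡_ φ → Fin m → Fin n
inverse φ-bij = bijective⇒permutation φ-bij ⟨$⟩ˡ_

inverseʳ : ∀ {n m} {φ : Fin n → Fin m} (φ-bij : Bijective _≡_ _≡_ φ) y → φ (inverse φ-bij y) ≡ y
inverseʳ φ-bij y = Perm.inverseʳ (bijective⇒permutation φ-bij)

inverse-injective : ∀ {n m} {φ : Fin n → Fin m} (φ-bij : Bijective _≡_ _≡_ φ) →
                    Injective _≡_ _≡_ (inverse φ-bij)
inverse-injective {φ = φ} φ-bij {a} {b} eq =
  trans (sym (inverseʳ φ-bij a)) (trans (cong φ eq) (inverseʳ φ-bij b))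

transpose-cases : ∀ {n} (u v w : Fin n) →
                  (w ≡ u × transpose u v w ≡ v) ⊎ (w ≢ u × w ≡ v × transpose u v w ≡ u) ⊎
                  (w ≢ u × w ≢ v × transpose u v w ≡ w)
transpose-cases u v w with w F.≟ u
... | yes w≡u = inj₁ (w≡u , refl)
... | no  w≢u with w F.≟ v
...   | yes w≡v = inj₂ (inj₁ (w≢u , w≡v , refl))
...   | no  w≢v = inj₂ (inj₂ (w≢u , w≢v , refl))

id-or-transpose : ∀ {n} {σ : Fin n → Fin n} → Injective _≡_ _≡_ σ → ∀ {u v} → u ≢ v →
                  (∀ w → σ w ≢ w → (w ≡ u ⊎ w ≡ v) × (σ w ≡ u ⊎ σ w ≡ v)) →
                  (∀ w → σ w ≡ w) ⊎ (∀ w → σ w ≡ transpose u v w)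
id-or-transpose {σ = σ} σ-inj {u} {v} u≢v moved with σ u F.≟ u
... | yes σu≡u = inj₁ (λ w → decidable-stable (σ w F.≟ w) (fixed w))
  where
  fixed : ∀ w → ¬ σ w ≢ w
  fixed w σw≢w with moved w σw≢w
  ... | inj₁ refl , _         = σw≢w σu≡u
  ... | inj₂ refl , inj₁ σv≡u = u≢v (σ-inj (trans σu≡u (sym σv≡u)))
  ... | inj₂ refl , inj₂ σv≡v = σw≢w σv≡v
... | no  σu≢u = inj₂ swapped
  where
  σu≡v : σ u ≡ v
  σu≡v with moved u σu≢u
  ... | _ , inj₁ σu≡u = contradiction σu≡u σu≢u
  ... | _ , inj₂ σu≡v = σu≡v
  σv≡u : σ v ≡ u
  σv≡u with σ v F.≟ v
  ... | yes σv≡v = contradiction (σ-inj (trans σu≡v (sym σv≡v))) u≢v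
  ... | no  σv≢v with moved v σv≢v
  ...   | _ , inj₁ σv≡u = σv≡u
  ...   | _ , inj₂ σv≡v = contradiction σv≡v σv≢v
  swapped : ∀ w → σ w ≡ transpose u v w
  swapped w with transpose-cases u v w
  ... | inj₁ (refl , t≡v)              = trans σu≡v (sym t≡v)
  ... | inj₂ (inj₁ (_ , refl , t≡u))   = trans σv≡u (sym t≡u)
  ... | inj₂ (inj₂ (w≢u , w≢v , t≡w))  = trans (decidable-stable (σ w F.≟ w) stays) (sym t≡w)
    where
    stays : ¬ σ w ≢ w
    stays σw≢w = [ w≢u , w≢v ]′ (proj₁ (moved w σw≢w))

-- Krylov sequences

downward-induction : ∀ {P : ℕ → Set} → (∀ j → P (suc j) → P j) → ∀ i {j} → P (i ℕ.+ j) → P j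
downward-induction         step zero        p = p
downward-induction {P = P} step (suc i) {j} p =
  step j (downward-induction step i (subst P (sym (ℕP.+-suc i j)) p))

extend : ∀ {N} → Vector ℚ N → ℕ → ℚ
extend {zero}  c k       = 0ℚ
extend {suc N} c zero    = c zero
extend {suc N} c (suc k) = extend (c ∘ suc) k

extend-toℕ : ∀ {N} (c : Vector ℚ N) k → extend c (toℕ k) ≡ c k
extend-toℕ c zero    = refl
extend-toℕ c (suc k) = extend-toℕ (c ∘ suc) k

extend-≥ : ∀ {N} (c : Vector ℚ N) {k} → N ℕ.≤ k → extend c k ≡ 0ℚ
extend-≥ {zero}  c         _            = refl
extend-≥ {suc N} c {suc k} (ℕ.s≤s N≤k) = extend-≥ (c ∘ suc) N≤k

delay : (ℕ → ℚ) → ℕ → ℚ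
delay e zero    = 0ℚ
delay e (suc k) = e k

module Krylov {n} (B : Fin n → Vector ℚ n) (X : ℕ → Vector ℚ n)
              (X-suc : ∀ k v → X (suc k) v ≡ B v · X k) where

  LinearRelation : ℕ → (ℕ → ℚ) → Set
  LinearRelation M e = ∀ v → linearCombination {M} (e ∘ toℕ) (X ∘ toℕ) v ≡ 0ℚ

  relation-combine : ∀ {M e e′} α β → LinearRelation M e → LinearRelation M e′ →
                     LinearRelation M (λ k → α * e k + β * e′ k)
  relation-combine {M} {e} {e′} α β e-rel e′-rel v = begin
    ∑[ k < M ] ((α * e (toℕ k) + β * e′ (toℕ k)) * X (toℕ k) v)
      ≡⟨ ℚΣ.sum-cong-≗ {M} (λ k → distribute α β (e (toℕ k)) (e′ (toℕ k)) (X (toℕ k) v)) ⟩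
    ∑[ k < M ] (α * (e (toℕ k) * X (toℕ k) v) + β * (e′ (toℕ k) * X (toℕ k) v))
      ≡⟨ ℚΣ.∑-distrib-+ {M} (λ k → α * (e (toℕ k) * X (toℕ k) v)) _ ⟩
    ∑[ k < M ] (α * (e (toℕ k) * X (toℕ k) v)) + ∑[ k < M ] (β * (e′ (toℕ k) * X (toℕ k) v))
      ≡⟨ cong₂ _+_ (ℚΣ.*-distribˡ-sum {M} α _) (ℚΣ.*-distribˡ-sum {M} β _) ⟨
    α * linearCombination {M} (e ∘ toℕ) (X ∘ toℕ) v + β * linearCombination {M} (e′ ∘ toℕ) (X ∘ toℕ) v
      ≡⟨ cong₂ (λ p q → α * p + β * q) (e-rel v) (e′-rel v) ⟩
    α * 0ℚ + β * 0ℚ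
      ≡⟨ solve 2 (λ α β → α :* con 0ℚ :+ β :* con 0ℚ := con 0ℚ) refl α β ⟩
    0ℚ ∎
    where
    open ≡-Reasoning
    distribute : ∀ α β p q x → (α * p + β * q) * x ≡ α * (p * x) + β * (q * x)
    distribute = solve 5 (λ α β p q x → (α :* p :+ β :* q) :* x := α :* (p :* x) :+ β :* (q :* x)) refl

  relation-snoc : ∀ {M e} → LinearRelation M e → e M ≡ 0ℚ → LinearRelation (suc M) e
  relation-snoc {M} {e} e-rel eM≡0 v = begin
    linearCombination {suc M} (e ∘ toℕ) (X ∘ toℕ) v
      ≡⟨ ℚΣ.sum-init-last {M} (λ k → e (toℕ k) * X (toℕ k) v) ⟩
    ∑[ k < M ] (term (toℕ (F.inject₁ k))) + term (toℕ (F.fromℕ M))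
      ≡⟨ cong₂ _+_ (ℚΣ.sum-cong-≗ {M} (λ k → cong term (FP.toℕ-inject₁ k))) (cong term (FP.toℕ-fromℕ M)) ⟩
    linearCombination {M} (e ∘ toℕ) (X ∘ toℕ) v + e M * X M v
      ≡⟨ cong₂ (λ p q → p + q * X M v) (e-rel v) eM≡0 ⟩
    0ℚ + 0ℚ * X M v
      ≡⟨ solve 1 (λ x → con 0ℚ :+ con 0ℚ :* x := con 0ℚ) refl (X M v) ⟩
    0ℚ ∎
    where
    open ≡-Reasoning
    term = λ i → e i * X i v

  relation-delay : ∀ {M e} → LinearRelation M e → LinearRelation (suc M) (delay e)
  relation-delay {M} {e} e-rel v = begin
    0ℚ * X 0 v + ∑[ k < M ] (e (toℕ k) * X (suc (toℕ k)) v)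
      ≡⟨ cong₂ _+_ (ℚP.*-zeroˡ (X 0 v)) (ℚΣ.sum-cong-≗ {M} (λ k → cong (e (toℕ k) *_) (X-suc (toℕ k) v))) ⟩
    0ℚ + ∑[ k < M ] (e (toℕ k) * (B v · X (toℕ k)))
      ≡⟨ ℚP.+-identityˡ _ ⟩
    ∑[ k < M ] (e (toℕ k) * (B v · X (toℕ k)))
      ≡⟨ ·-linearCombination (B v) (e ∘ toℕ {M}) (X ∘ toℕ) ⟨
    B v · linearCombination {M} (e ∘ toℕ) (X ∘ toℕ)
      ≡⟨ ℚΣ.sum-cong-≗ (λ w → cong (B v w *_) (e-rel w)) ⟩
    B v · (λ _ → 0ℚ)
      ≡⟨ ·-zeroʳ (B v) ⟩
    0ℚ ∎
    where open ≡-Reasoning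

  relation-off-image : ∀ {N} {f : Fin N → Fin (suc N)} → Injective _≡_ _≡_ f →
                       Independent (λ j → X (toℕ (f j))) → ∀ {m₀} → (∀ j → f j ≢ m₀) →
                       ∀ {e} → LinearRelation (suc N) e → e (toℕ m₀) ≡ 0ℚ →
                       ∀ (k : Fin (suc N)) → e (toℕ k) ≡ 0ℚ
  relation-off-image {N} {f} f-inj f-indep {m₀} m₀∉f {e} e-rel e[m₀]≡0 k =
    trans (cong (e ∘ toℕ) (sym (Perm.inverseʳ π))) (e∘h≡0 (π ⟨$⟩ˡ k))
    where
    open ≡-Reasoning
    h : Fin (suc N) → Fin (suc N)
    h = m₀ ∷ f
    h-inj : Injective _≡_ _≡_ h
    h-inj {zero}  {zero}  _  = refl
    h-inj {zero}  {suc j} eq = contradiction (sym eq) (m₀∉f j)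
    h-inj {suc i} {zero}  eq = contradiction eq (m₀∉f i)
    h-inj {suc i} {suc j} eq = cong suc (f-inj eq)
    π = bijective⇒permutation (injective⇒bijective h-inj)
    term : Fin (suc N) → Fin n → ℚ
    term k v = e (toℕ k) * X (toℕ k) v
    term[m₀]≡0 : ∀ v → term m₀ v ≡ 0ℚ
    term[m₀]≡0 v = trans (cong (_* X (toℕ m₀) v) e[m₀]≡0) (ℚP.*-zeroˡ (X (toℕ m₀) v))
    f-rel : ∀ v → linearCombination (e ∘ toℕ ∘ f) (X ∘ toℕ ∘ f) v ≡ 0ℚ
    f-rel v = begin
      ∑[ j < N ] (term (f j) v)                ≡⟨ ℚP.+-identityˡ _ ⟨
      0ℚ + ∑[ j < N ] (term (f j) v)           ≡⟨ cong (_+ ∑[ j < N ] (term (f j) v)) (term[m₀]≡0 v) ⟨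
      ∑[ i < suc N ] (term (h i) v)            ≡⟨ ℚΣ.sum-permute (λ k → term k v) π ⟨
      ∑[ k < suc N ] (term k v)                ≡⟨ e-rel v ⟩
      0ℚ                                       ∎
    e∘h≡0 : ∀ i → e (toℕ (h i)) ≡ 0ℚ
    e∘h≡0 zero    = e[m₀]≡0
    e∘h≡0 (suc j) = f-indep (e ∘ toℕ ∘ f) f-rel j

  -- If d₀ ≢ 0, the combination E of d = extend c and its delay that vanishes at m₀ is a relation,
  -- hence zero; as E (suc i) = d₀ * d i once d (suc i) = 0, d vanishes from the top down.
  relation-zero-at-gap : ∀ {N} {m₀ : Fin (suc N)} →
                         (∀ {e} → LinearRelation (suc N) e → e (toℕ m₀) ≡ 0ℚ →
                                  ∀ (k : Fin (suc N)) → e (toℕ k) ≡ 0ℚ) →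
                         ∀ (c : Vector ℚ N) → LinearRelation N (extend c) → extend c (toℕ m₀) ≡ 0ℚ
  relation-zero-at-gap {N} {m₀} vanishing c d-rel = decidable-stable (d₀ ℚP.≟ 0ℚ) λ d₀≢0 →
    d₀≢0 (downward-induction (step d₀≢0) N (extend-≥ c (ℕP.m≤m+n N (toℕ m₀))))
    where
    open ≡-Reasoning
    d = extend c
    d₀ = d (toℕ m₀)
    s₀ = delay d (toℕ m₀)
    E : ℕ → ℚ
    E i = d₀ * delay d i + - s₀ * d i
    E-vanishes : ∀ k → E (toℕ k) ≡ 0ℚ
    E-vanishes = vanishing {E}
      (relation-combine {suc N} {delay d} {d} d₀ (- s₀) (relation-delay {N} {d} d-rel)
                        (relation-snoc {N} {d} d-rel (extend-≥ c ℕP.≤-refl)))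
      (solve 2 (λ a b → a :* b :+ (:- b) :* a := con 0ℚ) refl d₀ s₀)
    step : d₀ ≢ 0ℚ → ∀ i → d (suc i) ≡ 0ℚ → d i ≡ 0ℚ
    step d₀≢0 i d[1+i]≡0 with i ℕP.<? N
    ... | no  i≮N = extend-≥ c (ℕP.≮⇒≥ i≮N)
    ... | yes i<N = p≢0∧p*q≡0⇒q≡0 d₀≢0 (begin
      d₀ * d i                         ≡⟨ solve 3 (λ a x b → a :* x := a :* x :+ (:- b) :* con 0ℚ) refl d₀ (d i) s₀ ⟩
      d₀ * d i + - s₀ * 0ℚ             ≡⟨ cong (λ t → d₀ * d i + - s₀ * t) d[1+i]≡0 ⟨
      E (suc i)                        ≡⟨ cong E (FP.toℕ-fromℕ< (ℕ.s≤s i<N)) ⟨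
      E (toℕ (F.fromℕ< (ℕ.s≤s i<N)))   ≡⟨ E-vanishes _ ⟩
      0ℚ                               ∎)

  krylov-independent : ∀ {N} {f : Fin N → Fin (suc N)} → Injective _≡_ _≡_ f →
                       Independent (λ j → X (toℕ (f j))) → Independent (λ (k : Fin N) → X (toℕ k))
  krylov-independent {N} {f} f-inj f-indep c c-rel j = begin
    c j                            ≡⟨ extend-toℕ c j ⟨
    extend c (toℕ j)               ≡⟨ cong (extend c) (FP.toℕ-inject₁ j) ⟨
    extend c (toℕ (F.inject₁ j))   ≡⟨ vanishing {extend c} d-rel′ d[m₀]≡0 (F.inject₁ j) ⟩
    0ℚ                             ∎
    where
    open ≡-Reasoning
    m₀ = proj₁ (injective⇒missing f-inj)
    vanishing : ∀ {e} → LinearRelation (suc N) e → e (toℕ m₀) ≡ 0ℚ → ∀ (k : Fin (suc N)) → e (toℕ k) ≡ 0ℚ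
    vanishing {e} = relation-off-image f-inj f-indep (proj₂ (injective⇒missing f-inj)) {e}
    d-rel : LinearRelation N (extend c)
    d-rel v = trans (ℚΣ.sum-cong-≗ {N} (λ k → cong (_* X (toℕ k) v) (extend-toℕ c k))) (c-rel v)
    d-rel′ : LinearRelation (suc N) (extend c)
    d-rel′ = relation-snoc {N} {extend c} d-rel (extend-≥ c ℕP.≤-refl)
    d[m₀]≡0 : extend c (toℕ m₀) ≡ 0ℚ
    d[m₀]≡0 = relation-zero-at-gap (λ {e} → vanishing {e}) c d-rel

-- Walks

ι : ℕ → ℚ
ι a = ℤ.+ a ℚ./ 1

ι≡mkℚ : ∀ a → ι a ≡ ℚ.mkℚ (ℤ.+ a) 0 (Coprimality.sym (Coprimality.1-coprimeTo a))
ι≡mkℚ a = ℚP.normalize-coprime (Coprimality.sym (Coprimality.1-coprimeTo a))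

ι-+ : ∀ a b → ι (a ℕ.+ b) ≡ ι a + ι b
ι-+ a b rewrite ι≡mkℚ a | ι≡mkℚ b = ℚP./-cong {p₁ = ℤ.+ (a ℕ.+ b)}
  (cong₂ ℤ._+_ (sym (ℤP.*-identityʳ (ℤ.+ a))) (sym (ℤP.*-identityʳ (ℤ.+ b)))) refl

ι-* : ∀ a b → ι (a ℕ.* b) ≡ ι a * ι b
ι-* a b rewrite ι≡mkℚ a | ι≡mkℚ b = ℚP./-cong {p₁ = ℤ.+ (a ℕ.* b)} (ℤP.pos-* a b) refl

ι-injective : ∀ {a b} → ι a ≡ ι b → a ≡ b
ι-injective {a} {b} eq with trans (sym (ι≡mkℚ a)) (trans eq (ι≡mkℚ b))
... | refl = refl

ι-sumFin-* : ∀ {n} (a b : Vector ℕ n) → ι (sumFin (λ w → a w ℕ.* b w)) ≡ (ι ∘ a) · (ι ∘ b)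
ι-sumFin-* {zero}  a b = refl
ι-sumFin-* {suc n} a b = trans (ι-+ (a zero ℕ.* b zero) _)
  (cong₂ _+_ (ι-* (a zero) (b zero)) (ι-sumFin-* (a ∘ suc) (b ∘ suc)))

sumFinℚ≡sum : ∀ {n} (f : Vector ℚ n) → sumFinℚ f ≡ sum f
sumFinℚ≡sum {zero}  f = refl
sumFinℚ≡sum {suc n} f = cong (f zero +_) (sumFinℚ≡sum (f ∘ suc))

sumFin≡sum : ∀ {n} (f : Vector ℕ n) → sumFin f ≡ ℕΣ.sum f
sumFin≡sum {zero}  f = refl
sumFin≡sum {suc n} f = cong (f zero ℕ.+_) (sumFin≡sum (f ∘ suc))

sumFin-cong : ∀ {n} {f g : Vector ℕ n} → (∀ i → f i ≡ g i) → sumFin f ≡ sumFin g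
sumFin-cong {f = f} {g} f≗g = trans (sumFin≡sum f) (trans (ℕΣ.sum-cong-≗ f≗g) (sym (sumFin≡sum g)))

sumFin-permute : ∀ {n m} (π : Permutation n m) (g : Vector ℕ m) → sumFin g ≡ sumFin (g ∘ (π ⟨$⟩ʳ_))
sumFin-permute π g =
  trans (sumFin≡sum g) (trans (ℕΣ.sum-permute g π) (sym (sumFin≡sum (g ∘ (π ⟨$⟩ʳ_)))))

b2n-injective : ∀ {a b} → b2n a ≡ b2n b → a ≡ b
b2n-injective {true}  {true}  _ = refl
b2n-injective {false} {false} _ = refl

adjacencyℚ : ∀ {n} → Graph n → Fin n → Vector ℚ n
adjacencyℚ G v w = ι (A G v w)

walkℚ : ∀ {n} → Graph n → VSet n → ℕ → Vector ℚ n
walkℚ G S k v = ι (walk G S k v)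

walkℚ-suc : ∀ {n} (G : Graph n) S k v → walkℚ G S (suc k) v ≡ adjacencyℚ G v · walkℚ G S k
walkℚ-suc G S k v = ι-sumFin-* (A G v) (walk G S k)

KrylovIndependent : ∀ {N} → Graph (suc N) → VSet (suc N) → Set
KrylovIndependent {N} G S = Independent (λ (k : Fin N) → walkℚ G S (toℕ k))

rank⇒krylovIndependent : ∀ {N} {G : Graph (suc N)} {S} → RankAtLeast G S N → KrylovIndependent G S
rank⇒krylovIndependent {G = G} {S} (f , f-inj , f-indep) = krylov-independent f-inj λ c c-rel →
  f-indep c (λ v → trans (sumFinℚ≡sum (λ j → c j * walkℚ G S (toℕ (f j)) v)) (c-rel v))
  where open Krylov (adjacencyℚ G) (walkℚ G S) (walkℚ-suc G S)

walk-transport : ∀ {n m} {G : Graph n} {G* : Graph m} (π : Permutation n m) →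
                 (∀ i j → adj G* (π ⟨$⟩ʳ i) (π ⟨$⟩ʳ j) ≡ adj G i j) →
                 ∀ S k v → walk G* (S ∘ (π ⟨$⟩ˡ_)) k (π ⟨$⟩ʳ v) ≡ walk G S k v
walk-transport π adj-pres S zero    v = cong (b2n ∘ S) (Perm.inverseˡ π)
walk-transport {G = G} {G*} π adj-pres S (suc k) v = begin
  sumFin (λ j → A G* (π ⟨$⟩ʳ v) j ℕ.* walk G* S* k j)
    ≡⟨ sumFin-permute π _ ⟩
  sumFin (λ w → A G* (π ⟨$⟩ʳ v) (π ⟨$⟩ʳ w) ℕ.* walk G* S* k (π ⟨$⟩ʳ w))
    ≡⟨ sumFin-cong (λ w → cong₂ ℕ._*_ (cong b2n (adj-pres v w)) (walk-transport π adj-pres S k w)) ⟩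
  sumFin (λ w → A G v w ℕ.* walk G S k w)
    ∎
  where
  open ≡-Reasoning
  S* = S ∘ (π ⟨$⟩ˡ_)

iso⇒walkEquivalent : ∀ {n m} {G : Graph n} {G* : Graph m} {φ} (S : VSet n) → IsIso G G* φ →
                     ∃[ S* ] WalkEquiv G S G* S*
iso⇒walkEquivalent {φ = φ} S (φ-bij , adj-pres) =
  S ∘ (π ⟨$⟩ˡ_) , Perm.↔⇒≡ π , φ , φ-bij , (λ v k _ → walk-transport π adj-pres S k v)
  where π = bijective⇒permutation φ-bij

matching-step : ∀ {n m} {G : Graph n} {G* : Graph m} {S S* φ} → MatchingBij G S G* S* φ →
                ∀ v k → suc k ℕ.< n →
                sumFin (λ w → A G* (φ v) (φ w) ℕ.* walk G S k w) ≡ walk G S (suc k) v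
matching-step {G = G} {G*} {S} {S*} {φ} (φ-bij , rows) v k 1+k<n = begin
  sumFin (λ w → A G* (φ v) (φ w) ℕ.* walk G S k w)
    ≡⟨ sumFin-cong (λ w → cong (A G* (φ v) (φ w) ℕ.*_) (rows w k (ℕP.<⇒≤ 1+k<n))) ⟨
  sumFin (λ w → A G* (φ v) (φ w) ℕ.* walk G* S* k (φ w))
    ≡⟨ sumFin-permute (bijective⇒permutation φ-bij) _ ⟨
  walk G* S* (suc k) (φ v)
    ≡⟨ rows v (suc k) 1+k<n ⟩
  walk G S (suc k) v
    ∎
  where open ≡-Reasoning

matching⇒iso : ∀ {N m} {G : Graph (suc N)} {G* : Graph m} {S S* φ} →
               KrylovIndependent G S → MatchingBij G S G* S* φ → IsIso G G* φ
matching⇒iso {N} {G = G} {G*} {S} {S*} {φ} indep matching = proj₁ matching , adj-pres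
  where
  open ≡-Reasoning
  A*φ : Fin (suc N) → Vector ℚ (suc N)
  A*φ v w = ι (A G* (φ v) (φ w))
  D : Fin (suc N) → Vector ℚ (suc N)
  D v w = adjacencyℚ G v w - A*φ v w
  D-sym : ∀ i j → D i j ≡ D j i
  D-sym i j = cong₂ (λ a b → ι (b2n a) - ι (b2n b)) (Graph.sym G i j) (Graph.sym G* (φ i) (φ j))
  D-hollow : ∀ i → D i i ≡ 0ℚ
  D-hollow i = cong₂ (λ a b → ι (b2n a) - ι (b2n b)) (Graph.irrefl G i) (Graph.irrefl G* (φ i))
  D⊥walks : ∀ v (k : Fin N) → D v · walkℚ G S (toℕ k) ≡ 0ℚ
  D⊥walks v k = begin
    D v · X
      ≡⟨ ·-distribʳ-− (adjacencyℚ G v) (A*φ v) X ⟩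
    adjacencyℚ G v · X - A*φ v · X
      ≡⟨ cong₂ _-_ (walkℚ-suc G S (toℕ k) v) (ι-sumFin-* (λ w → A G* (φ v) (φ w)) (walk G S (toℕ k))) ⟨
    walkℚ G S (suc (toℕ k)) v - ι (sumFin (λ w → A G* (φ v) (φ w) ℕ.* walk G S (toℕ k) w))
      ≡⟨ cong (λ t → walkℚ G S (suc (toℕ k)) v - ι t) (matching-step matching v (toℕ k) (ℕ.s≤s (FP.toℕ<n k))) ⟩
    walkℚ G S (suc (toℕ k)) v - walkℚ G S (suc (toℕ k)) v
      ≡⟨ ℚP.+-inverseʳ (walkℚ G S (suc (toℕ k)) v) ⟩
    0ℚ ∎
    where X = walkℚ G S (toℕ k)
  adj-pres : ∀ i j → adj G* (φ i) (φ j) ≡ adj G i j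
  adj-pres i j = sym (b2n-injective (ι-injective (x-y≡0⇒x≡y
    (symmetric-hollow-annihilator≡0 _ indep D D-sym D-hollow D⊥walks i j))))

inverse∘matching-fixes-rows : ∀ {n m} {G : Graph n} {G* : Graph m} {S S* φ ψ}
                              (φ-match : MatchingBij G S G* S* φ) → MatchingBij G S G* S* ψ →
                              ∀ w → RowEq G S (inverse (proj₁ φ-match) (ψ w)) w
inverse∘matching-fixes-rows {G = G} {G*} {S} {S*} {φ} {ψ} (φ-bij , φ-rows) (_ , ψ-rows) w k k<n = begin
  walk G S k (inverse φ-bij (ψ w))         ≡⟨ φ-rows (inverse φ-bij (ψ w)) k k<n ⟨
  walk G* S* k (φ (inverse φ-bij (ψ w)))   ≡⟨ cong (walk G* S* k) (inverseʳ φ-bij (ψ w)) ⟩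
  walk G* S* k (ψ w)                       ≡⟨ ψ-rows w k k<n ⟩
  walk G S k w                             ∎
  where open ≡-Reasoning

rowEq⇒krylov : ∀ {N} {G : Graph (suc N)} {S a b} → RowEq G S a b →
               ∀ (k : Fin N) → walkℚ G S (toℕ k) a ≡ walkℚ G S (toℕ k) b
rowEq⇒krylov a≈b k = cong ι (a≈b (toℕ k) (ℕP.m<n⇒m<1+n (FP.toℕ<n k)))

rowEq-transpose : ∀ {n} {G : Graph n} {S u v} → RowEq G S u v → ∀ w → RowEq G S (transpose u v w) w
rowEq-transpose {G = G} {S} {u} {v} u≈v w k k<n with transpose-cases u v w
... | inj₁ (refl , t≡v)              = trans (cong (walk G S k) t≡v) (sym (u≈v k k<n))
... | inj₂ (inj₁ (_ , refl , t≡u))  = trans (cong (walk G S k) t≡u) (u≈v k k<n)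
... | inj₂ (inj₂ (_ , _ , t≡w))      = cong (walk G S k) t≡w

matching-unique : ∀ {n m} {G : Graph n} {G* : Graph m} {S S* φ ψ} → RowsDistinct G S →
                  MatchingBij G S G* S* φ → MatchingBij G S G* S* ψ → ψ ≗ᶠ φ
matching-unique {φ = φ} {ψ} distinct φ-match ψ-match w = begin
  ψ w       ≡⟨ inverseʳ (proj₁ φ-match) (ψ w) ⟨
  φ (σ w)   ≡⟨ cong φ (decidable-stable (σ w F.≟ w) σw≢w-absurd) ⟩
  φ w       ∎
  where
  open ≡-Reasoning
  σ = inverse (proj₁ φ-match) ∘ ψ
  σw≢w-absurd : ¬ σ w ≢ w
  σw≢w-absurd σw≢w = distinct (σ w) w σw≢w (inverse∘matching-fixes-rows φ-match ψ-match w)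

repeated-row⇒two-matchings : ∀ {N m} {G : Graph (suc N)} {G* : Graph m} {S S* φ} →
  KrylovIndependent G S → HasRepeatedRow G S → MatchingBij G S G* S* φ →
  ∃[ φ₁ ] ∃[ φ₂ ] (MatchingBij G S G* S* φ₁ × MatchingBij G S G* S* φ₂ × ¬ (φ₁ ≗ᶠ φ₂) ×
                   (∀ ψ → MatchingBij G S G* S* ψ → (ψ ≗ᶠ φ₁) ⊎ (ψ ≗ᶠ φ₂)))
repeated-row⇒two-matchings {N} {G = G} {G*} {S} {S*} {φ} indep (u , v , u≢v , u≈v) φ-match@(φ-bij , φ-rows) =
  φ , φ ∘ transpose u v , φ-match , φ₂-match , φ≢φ₂ , classify
  where
  φ₂-match : MatchingBij G S G* S* (φ ∘ transpose u v)
  φ₂-match = Compose.bijective _≡_ _≡_ _≡_ (Bijection.bijective (↔⇒⤖ (Perm.transpose u v))) φ-bij ,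
             λ w k k<n → trans (φ-rows (transpose u v w) k k<n) (rowEq-transpose u≈v w k k<n)
  φ≢φ₂ : ¬ (φ ≗ᶠ (φ ∘ transpose u v))
  φ≢φ₂ same with transpose-cases u v u
  ... | inj₁ (_ , t≡v)          = u≢v (proj₁ φ-bij (trans (same u) (cong φ t≡v)))
  ... | inj₂ (inj₁ (u≢u , _))   = u≢u refl
  ... | inj₂ (inj₂ (u≢u , _))   = u≢u refl
  x : Fin N → Vector ℚ (suc N)
  x k = walkℚ G S (toℕ k)
  moved : ∀ {ψ} → MatchingBij G S G* S* ψ → ∀ w → inverse φ-bij (ψ w) ≢ w →
          (w ≡ u ⊎ w ≡ v) × (inverse φ-bij (ψ w) ≡ u ⊎ inverse φ-bij (ψ w) ≡ v)
  moved ψ-match w σw≢w =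
    identified-pairs-coincide x indep u≢v (≢-sym σw≢w) (rowEq⇒krylov u≈v) (λ k → sym (rowEq⇒krylov σw≈w k)) ,
    identified-pairs-coincide x indep u≢v σw≢w (rowEq⇒krylov u≈v) (rowEq⇒krylov σw≈w)
    where σw≈w = inverse∘matching-fixes-rows φ-match ψ-match w
  classify : ∀ ψ → MatchingBij G S G* S* ψ → (ψ ≗ᶠ φ) ⊎ (ψ ≗ᶠ (φ ∘ transpose u v))
  classify ψ ψ-match
    with id-or-transpose (Compose.injective _≡_ _≡_ _≡_ (proj₁ (proj₁ ψ-match)) (inverse-injective φ-bij))
                         u≢v (moved ψ-match)
  ... | inj₁ σ≗id = inj₁ (λ w → trans (sym (inverseʳ φ-bij (ψ w))) (cong φ (σ≗id w)))
  ... | inj₂ σ≗t  = inj₂ (λ w → trans (sym (inverseʳ φ-bij (ψ w))) (cong φ (σ≗t w)))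

theorem6p3 : ∀ {n m} (G : Graph n) (G* : Graph m) (S : VSet n) →
    NonEmpty S → RankAtLeast G S (n ∸ 1) →
    (Isomorphic G G* ⇔ (∃[ S* ] WalkEquiv G S G* S*)) ×
    (∀ (S* : VSet m) → WalkEquiv G S G* S* →
      (∀ (φ : Fin n → Fin m) → MatchingBij G S G* S* φ → IsIso G G* φ) ×
      (RowsDistinct G S →
        ∃[ φ ] (MatchingBij G S G* S* φ ×
          (∀ ψ → MatchingBij G S G* S* ψ → ψ ≗ᶠ φ))) ×
      (HasRepeatedRow G S →
        ∃[ φ₁ ] ∃[ φ₂ ] (MatchingBij G S G* S* φ₁ × MatchingBij G S G* S* φ₂ ×
          ¬ (φ₁ ≗ᶠ φ₂) ×
          (∀ ψ → MatchingBij G S G* S* ψ → (ψ ≗ᶠ φ₁) ⊎ (ψ ≗ᶠ φ₂)))))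
theorem6p3 {zero}  G G* S (() , _) _
theorem6p3 {suc N} G G* S _ rank =
  mk⇔ (λ (_ , φ-iso) → iso⇒walkEquivalent S φ-iso)
      (λ (_ , _ , φ , φ-match) → φ , matching⇒iso indep φ-match) ,
  λ S* (_ , φ , φ-match) →
    (λ _ → matching⇒iso indep) ,
    (λ distinct → φ , φ-match , λ ψ ψ-match → matching-unique distinct φ-match ψ-match) ,
    (λ repeated → repeated-row⇒two-matchings indep repeated φ-match)
  where
  indep : KrylovIndependent G S
  indep = rank⇒krylovIndependent rank
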